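{- For $r\ge 1$, let $FH(r)$ be the graph obtained from the complete graph $K_4$ on vertices $a,b,c,d$ by adding $r$ new vertices, each adjacent exactly to $a$ and $b$. Then $\operatorname{Z}_-(FH(r))=r$, $\overline{\operatorname{Z}}_-(FH(r))=r+2$, $\underline{z^-_0}(FH(r))=r+1$, and $z^-_0(FH(r))=r+3$.
   Context: All graphs are finite, simple, undirected. Skew color change rule: given the current white set $W$, any vertex $u$ may turn a white vertex $w$ blue if $N(u)\cap W=\{w\}$. A skew forcing set is a set $S$ such that starting with exactly $S$ blue, repeated application makes every vertex blue. $\operatorname{Z}_-(G)$ is the minimum size of a skew forcing set, $\overline{\operatorname{Z}}_-(G)$ the maximum size of an inclusion-minimal skew forcing set. The skew TAR graph $\mathfrak{Z}^-(G)$ has the skew forcing sets as vertices, two adjacent iff their symmetric difference has exactly one element; $\mathfrak{Z}^-_k(G)$ is its subgraph induced by skew forcing sets of size at most $k$. $\underline{z^-_0}(G)$ is the least $k$ such that $\mathfrak{Z}^-_k(G)$ is connected, and $z^-_0(G)$ is the least $k_0$ such that $\mathfrak{Z}^-_k(G)$ is connected for all $k\ge k_0$. ($FH(1)$ is the "Full House" graph.) -}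

module Defs where

open import Data.Nat using (ℕ; zero; suc; _+_; _≤_)
open import Data.Bool using (Bool; true; false)
open import Data.Fin using (Fin; zero; suc)
open import Data.Fin.Subset using (Subset; _∈_; _∉_; _⊂_; _∪_; ⁅_⁆; ⊤; ∣_∣)
open import Data.Product using (Σ; ∃; _×_; _,_)
open import Data.Sum using (_⊎_)
open import Relation.Binary.PropositionalEquality using (_≡_; refl)
open import Relation.Nullary using (¬_)

record Graph (n : ℕ) : Set where
  field
    adj     : Fin n → Fin n → Bool
    sym     : ∀ u v → adj u v ≡ adj v u
    irrefl  : ∀ u → adj u u ≡ false

open Graph public

Edge : ∀ {n} → Graph n → Fin n → Fin n → Set
Edge G u v = adj G u v ≡ true

-- Skew color change rule.  B is the current blue set, W = complement.
-- u turns w blue iff N(u) ∩ W = {w}  (u may be any vertex).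

SkewForce : ∀ {n} → Graph n → Subset n → Fin n → Fin n → Set
SkewForce G B u w =
  w ∉ B × Edge G u w × (∀ v → v ∉ B → Edge G u v → v ≡ w)

data Reachable {n} (G : Graph n) (S : Subset n) : Subset n → Set where
  start : Reachable G S S
  step  : ∀ {B} u w → Reachable G S B → SkewForce G B u w →
          Reachable G S (B ∪ ⁅ w ⁆)

IsSkewForcingSet : ∀ {n} → Graph n → Subset n → Set
IsSkewForcingSet G S = Reachable G S ⊤

SkewZeroForcingNumber : ∀ {n} → Graph n → ℕ → Set
SkewZeroForcingNumber G k =
  (∃ λ S → IsSkewForcingSet G S × ∣ S ∣ ≡ k) ×
  (∀ S → IsSkewForcingSet G S → k ≤ ∣ S ∣)

IsMinimalSkewForcingSet : ∀ {n} → Graph n → Subset n → Set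
IsMinimalSkewForcingSet G S =
  IsSkewForcingSet G S × (∀ T → T ⊂ S → ¬ IsSkewForcingSet G T)

UpperSkewZeroForcingNumber : ∀ {n} → Graph n → ℕ → Set
UpperSkewZeroForcingNumber G k =
  (∃ λ S → IsMinimalSkewForcingSet G S × ∣ S ∣ ≡ k) ×
  (∀ S → IsMinimalSkewForcingSet G S → ∣ S ∣ ≤ k)

TARAdjacent : ∀ {n} → Subset n → Subset n → Set
TARAdjacent {n} S T = ∃ λ (x : Fin n) →
  (x ∉ S × T ≡ S ∪ ⁅ x ⁆) ⊎ (x ∉ T × S ≡ T ∪ ⁅ x ⁆)

TARVertex : ∀ {n} → Graph n → ℕ → Subset n → Set
TARVertex G k S = IsSkewForcingSet G S × ∣ S ∣ ≤ k

data TARPath {n} (G : Graph n) (k : ℕ) : Subset n → Subset n → Set where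
  here  : ∀ {S} → TARPath G k S S
  there : ∀ {S T U} → TARVertex G k T → TARAdjacent S T →
          TARPath G k T U → TARPath G k S U

TARConnected : ∀ {n} → Graph n → ℕ → Set
TARConnected G k =
  (∃ λ S → TARVertex G k S) ×
  (∀ S T → TARVertex G k S → TARVertex G k T → TARPath G k S T)

LowerSkewTARConnNumber : ∀ {n} → Graph n → ℕ → Set
LowerSkewTARConnNumber G m =
  TARConnected G m × (∀ k → TARConnected G k → m ≤ k)

SkewTARConnNumber : ∀ {n} → Graph n → ℕ → Set
SkewTARConnNumber G m =
  (∀ k → m ≤ k → TARConnected G k) ×
  (∀ k₀ → (∀ k → k₀ ≤ k → TARConnected G k) → m ≤ k₀)

data Kind : Set where
  a b c d new : Kind

kind : ∀ {r} → Fin (4 + r) → Kind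
kind zero                         = a
kind (suc zero)                   = b
kind (suc (suc zero))             = c
kind (suc (suc (suc zero)))       = d
kind (suc (suc (suc (suc _))))    = new

kadj : Kind → Kind → Bool
kadj a b = true
kadj a c = true
kadj a d = true
kadj a new = true
kadj b a = true
kadj b c = true
kadj b d = true
kadj b new = true
kadj c a = true
kadj c b = true
kadj c d = true
kadj d a = true
kadj d b = true
kadj d c = true
kadj new a = true
kadj new b = true
kadj _ _ = false

kadj-sym : ∀ x y → kadj x y ≡ kadj y x
kadj-sym a a = refl
kadj-sym a b = refl
kadj-sym a c = refl
kadj-sym a d = refl
kadj-sym a new = refl
kadj-sym b a = refl
kadj-sym b b = refl
kadj-sym b c = refl
kadj-sym b d = refl
kadj-sym b new = refl
kadj-sym c a = refl
kadj-sym c b = refl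
kadj-sym c c = refl
kadj-sym c d = refl
kadj-sym c new = refl
kadj-sym d a = refl
kadj-sym d b = refl
kadj-sym d c = refl
kadj-sym d d = refl
kadj-sym d new = refl
kadj-sym new a = refl
kadj-sym new b = refl
kadj-sym new c = refl
kadj-sym new d = refl
kadj-sym new new = refl

kadj-irrefl : ∀ x → kadj x x ≡ false
kadj-irrefl a = refl
kadj-irrefl b = refl
kadj-irrefl c = refl
kadj-irrefl d = refl
kadj-irrefl new = refl

FH : (r : ℕ) → Graph (4 + r)
FH r = record
  { adj    = λ u v → kadj (kind u) (kind v)
  ; sym    = λ u v → kadj-sym (kind u) (kind v)
  ; irrefl = λ u → kadj-irrefl (kind u)
  }

-- The new vertices are pairwise twins, so two white new vertices can never be forced and a
-- skew forcing set contains all new vertices but at most one. If it also misses a and b, then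
-- every vertex has at least two white neighbours among a, b and any further white vertex, so
-- nothing happens unless the set is {c, d} ∪ new. Conversely {a} ∪ (new − j), {b} ∪ (new − j)
-- and {c, d} ∪ new force, so these are the inclusion-minimal skew forcing sets, of sizes r, r
-- and r + 2. A minimal set of size k is an isolated vertex of 𝔷⁻_k, which disconnects 𝔷⁻_r and
-- 𝔷⁻_{r+2}; for other k ≥ r + 1 any two vertices are joined by shrinking both to a common
-- minimal subset, except {c, d} ∪ new, which is joined to {a} ∪ new through {a, c, d} ∪ new.
module Submission where

open import Defs hiding (sym)
open import Data.Nat using (ℕ; zero; suc; _+_; _∸_; _≤_; _<_)
open import Data.Nat.Properties
  using (≤-refl; ≤-reflexive; ≤-trans; <⇒≤; <⇒≱; ≤∧≢⇒<; m≤n+m; n≤1+n; n≮n; ≤-pred; ≰⇒>; +-comm; _≤?_)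
open import Data.Nat.Induction using (<-wellFounded)
open import Data.Bool using (true; false)
open import Data.Fin using (Fin; zero; suc)
open import Data.Fin.Properties using (_≟_)
open import Data.Fin.Subset
open import Data.Fin.Subset.Properties
open import Data.Vec using ([]; _∷_; here; there)
open import Data.Product using (∃; _×_; _,_; proj₁; proj₂)
open import Data.Sum using (_⊎_; inj₁; inj₂; [_,_]′; map₁)
open import Data.Empty using (⊥-elim)
open import Function using (_∘_; case_of_)
open import Induction.WellFounded using (Acc; acc)
open import Relation.Binary.PropositionalEquality
  using (_≡_; _≢_; refl; trans; cong; subst) renaming (sym to ≡-sym)
open import Relation.Nullary using (¬_; yes; no; contradiction)

private variable
  n k : ℕ
  x y u w : Fin n
  p q S S′ T B : Subset n
  G : Graph n

x∉p∪⁅y⁆ : x ∉ p → x ≢ y → x ∉ p ∪ ⁅ y ⁆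
x∉p∪⁅y⁆ {p = p} {y = y} x∉p x≢y =
  [ x∉p , x≢y ∘ x∈⁅y⁆⇒x≡y y ]′ ∘ x∈p∪q⁻ p ⁅ y ⁆

x∉p⇒p⊂p∪⁅x⁆ : x ∉ p → p ⊂ p ∪ ⁅ x ⁆
x∉p⇒p⊂p∪⁅x⁆ {x = x} x∉p = p⊆p∪q ⁅ x ⁆ , x , x∈p∪q⁺ (inj₂ (x∈⁅x⁆ x)) , x∉p

x∉p-x : ∀ (p : Subset n) x → x ∉ p - x
x∉p-x (_ ∷ p) zero    ()
x∉p-x (_ ∷ p) (suc x) (there x∈p-x) = x∉p-x p x x∈p-x

x∈p⇒p-x∪⁅x⁆≡p : x ∈ p → (p - x) ∪ ⁅ x ⁆ ≡ p
x∈p⇒p-x∪⁅x⁆≡p {x = x} {p = p} x∈p = ⊆-antisym ⊆p ⊇p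
  where
  ⊆p : (p - x) ∪ ⁅ x ⁆ ⊆ p
  ⊆p y∈ = [ p─q⊆p p ⁅ x ⁆ , (λ y∈⁅x⁆ → subst (_∈ p) (≡-sym (x∈⁅y⁆⇒x≡y x y∈⁅x⁆)) x∈p) ]′
            (x∈p∪q⁻ (p - x) ⁅ x ⁆ y∈)
  ⊇p : p ⊆ (p - x) ∪ ⁅ x ⁆
  ⊇p {y} y∈p with y ≟ x
  ... | yes refl = x∈p∪q⁺ (inj₂ (x∈⁅x⁆ x))
  ... | no y≢x   = x∈p∪q⁺ (inj₁ (x∈p∧x≢y⇒x∈p-y y∈p y≢x))

p⊆q⇒p≡q⊎p⊂q : p ⊆ q → p ≡ q ⊎ p ⊂ q
p⊆q⇒p≡q⊎p⊂q {p = p} {q = q} p⊆q with p ⊂? q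
... | yes p⊂q = inj₂ p⊂q
... | no p⊄q  = inj₁ (⊆-antisym p⊆q q⊆p)
  where
  q⊆p : q ⊆ p
  q⊆p {x} x∈q with x ∈? p
  ... | yes x∈p = x∈p
  ... | no x∉p  = contradiction ((λ {z} → p⊆q {z}) , x , x∈q , x∉p) p⊄q

p≡⊤⊎∃∉ : ∀ (p : Subset n) → p ≡ ⊤ ⊎ ∃ (_∉ p)
p≡⊤⊎∃∉ []          = inj₁ refl
p≡⊤⊎∃∉ (false ∷ p) = inj₂ (zero , λ ())
p≡⊤⊎∃∉ (true ∷ p) with p≡⊤⊎∃∉ p
... | inj₁ refl        = inj₁ refl
... | inj₂ (x , x∉p)   = inj₂ (suc x , x∉p ∘ drop-there)

∣∁⁅x⁆∣≡n : ∀ (x : Fin (suc n)) → ∣ ∁ ⁅ x ⁆ ∣ ≡ n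
∣∁⁅x⁆∣≡n {n} x = trans (∣∁p∣≡n∸∣p∣ ⁅ x ⁆) (cong (suc n ∸_) (∣⁅x⁆∣≡1 x))

∁⁅x⁆∪⁅x⁆≡⊤ : ∀ (x : Fin n) → ∁ ⁅ x ⁆ ∪ ⁅ x ⁆ ≡ ⊤
∁⁅x⁆∪⁅x⁆≡⊤ x = trans (∪-comm (∁ ⁅ x ⁆) ⁅ x ⁆) (p∪∁p≡⊤ ⁅ x ⁆)

-- Skew forcing in an arbitrary graph

Edge-sym : Edge G u w → Edge G w u
Edge-sym {G = G} {u} {w} e = trans (Graph.sym G w u) e

extend : ∀ u w → Reachable G S B → SkewForce G B u w → B ∪ ⁅ w ⁆ ≡ S′ → Reachable G S S′
extend u w R F refl = step u w R F

reachable-trans : Reachable G S B → Reachable G B T → Reachable G S T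
reachable-trans R start          = R
reachable-trans R (step u w R′ F) = step u w (reachable-trans R R′) F

reachable-mono : S ⊆ S′ → Reachable G S B → ∃ λ B′ → Reachable G S′ B′ × B ⊆ B′
reachable-mono S⊆S′ start = _ , start , S⊆S′
reachable-mono S⊆S′ (step u w R (_ , uw , only)) with reachable-mono S⊆S′ R
... | B′ , R′ , B⊆B′ with w ∈? B′
...   | yes w∈B′ = B′ , R′ , λ v∈ →
          [ B⊆B′ , (λ v∈⁅w⁆ → subst (_∈ B′) (≡-sym (x∈⁅y⁆⇒x≡y w v∈⁅w⁆)) w∈B′) ]′ (x∈p∪q⁻ _ _ v∈)
...   | no w∉B′  = B′ ∪ ⁅ w ⁆ , step u w R′ (w∉B′ , uw , λ v v∉ → only v (v∉ ∘ B⊆B′)) ,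
          λ v∈ → x∈p∪q⁺ (map₁ B⊆B′ (x∈p∪q⁻ _ _ v∈))

forcing-mono : S ⊆ S′ → IsSkewForcingSet G S → IsSkewForcingSet G S′
forcing-mono S⊆S′ F with reachable-mono S⊆S′ F
... | B′ , R′ , ⊤⊆B′ = subst (Reachable _ _) (⊆-antisym ⊆⊤ ⊤⊆B′) R′

SameNeighbours : Graph n → Fin n → Fin n → Set
SameNeighbours G x y = ∀ u → adj G u x ≡ adj G u y

twin-not-forced : (Edge G u x → Edge G u y) → x ≢ y → y ∉ B → SkewForce G B u w → x ≢ w
twin-not-forced toY x≢y y∉B (_ , ux , only) refl = x≢y (≡-sym (only _ y∉B (toY ux)))

twins-stay-white : SameNeighbours G x y → x ≢ y → x ∉ S → y ∉ S →
                   Reachable G S B → x ∉ B × y ∉ B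
twins-stay-white same x≢y x∉S y∉S start = x∉S , y∉S
twins-stay-white {G = G} same x≢y x∉S y∉S (step u w R F) =
  let x∉B , y∉B = twins-stay-white same x≢y x∉S y∉S R in
  x∉p∪⁅y⁆ x∉B (twin-not-forced {G = G} (trans (≡-sym (same u))) x≢y y∉B F) ,
  x∉p∪⁅y⁆ y∉B (twin-not-forced {G = G} (trans (same u)) (x≢y ∘ ≡-sym) x∉B F)

twins-not-forcing : SameNeighbours G x y → x ≢ y → x ∉ S → y ∉ S → ¬ IsSkewForcingSet G S
twins-not-forcing same x≢y x∉S y∉S F = proj₁ (twins-stay-white same x≢y x∉S y∉S F) ∈⊤

Stalled : Graph n → Subset n → Set
Stalled G B = ∀ u w → ¬ SkewForce G B u w

stalled-reachable : Stalled G S → Reachable G S B → B ≡ S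
stalled-reachable st start = refl
stalled-reachable st (step u w R F) with stalled-reachable st R
... | refl = ⊥-elim (st u w F)

stalled⇒not-forcing : Stalled G S → x ∉ S → ¬ IsSkewForcingSet G S
stalled⇒not-forcing {x = x} st x∉S F = x∉S (subst (x ∈_) (stalled-reachable st F) ∈⊤)

minimum⇒minimal : SkewZeroForcingNumber G k → IsSkewForcingSet G S → ∣ S ∣ ≡ k →
                  IsMinimalSkewForcingSet G S
minimum⇒minimal (_ , least) F refl = F , λ T T⊂S FT → <⇒≱ (p⊂q⇒∣p∣<∣q∣ T⊂S) (least T FT)

minimal-⊆ : IsMinimalSkewForcingSet G S → T ⊆ S → IsSkewForcingSet G T → T ≡ S
minimal-⊆ (_ , minimal) T⊆S FT with p⊆q⇒p≡q⊎p⊂q T⊆S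
... | inj₁ T≡S = T≡S
... | inj₂ T⊂S = ⊥-elim (minimal _ T⊂S FT)

-- Skew TAR graphs

TARAdjacent-sym : TARAdjacent S T → TARAdjacent T S
TARAdjacent-sym (x , inj₁ adj) = x , inj₂ adj
TARAdjacent-sym (x , inj₂ adj) = x , inj₁ adj

TARPath-trans : TARPath G k S T → TARPath G k T S′ → TARPath G k S S′
TARPath-trans here            Q = Q
TARPath-trans (there vT adj P) Q = there vT adj (TARPath-trans P Q)

TARPath-sym : TARVertex G k S → TARPath G k S T → TARPath G k T S
TARPath-sym vS here              = here
TARPath-sym vS (there vU adj P) = TARPath-trans (TARPath-sym vU P) (there vS (TARAdjacent-sym adj) here)

-- Removing the elements of S ∖ T one at a time stays above the forcing set T.
⊆⇒TARPath : T ⊆ S → IsSkewForcingSet G T → ∣ S ∣ ≤ k → TARPath G k S T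
⊆⇒TARPath {T = T} {S = S} {G = G} {k = k} T⊆S FT S≤k = go (<-wellFounded ∣ S ∣) T⊆S S≤k
  where
  go : ∀ {S} → Acc _<_ ∣ S ∣ → T ⊆ S → ∣ S ∣ ≤ k → TARPath G k S T
  go {S} (acc smaller) T⊆S S≤k with p⊆q⇒p≡q⊎p⊂q T⊆S
  ... | inj₁ refl = here
  ... | inj₂ (_ , x , x∈S , x∉T) =
    there (forcing-mono T⊆S-x FT , ≤-trans (<⇒≤ S-x<S) S≤k)
          (x , inj₂ (x∉p-x S x , ≡-sym (x∈p⇒p-x∪⁅x⁆≡p x∈S)))
          (go (smaller S-x<S) T⊆S-x (≤-trans (<⇒≤ S-x<S) S≤k))
    where
    S-x<S : ∣ S - x ∣ < ∣ S ∣
    S-x<S = x∈p⇒∣p-x∣<∣p∣ x∈S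
    T⊆S-x : T ⊆ S - x
    T⊆S-x y∈T = x∈p∧x≢y⇒x∈p-y (T⊆S y∈T) λ { refl → x∉T y∈T }

common-subset⇒TARPath : T ⊆ S → T ⊆ S′ → IsSkewForcingSet G T →
                        ∣ S ∣ ≤ k → TARVertex G k S′ → TARPath G k S S′
common-subset⇒TARPath T⊆S T⊆S′ FT S≤k vS′@(_ , S′≤k) =
  TARPath-trans (⊆⇒TARPath T⊆S FT S≤k) (TARPath-sym vS′ (⊆⇒TARPath T⊆S′ FT S′≤k))

common-superset⇒TARPath : S ⊆ B → S′ ⊆ B → IsSkewForcingSet G S′ →
                          ∣ B ∣ ≤ k → TARVertex G k S → TARPath G k S S′
common-superset⇒TARPath S⊆B S′⊆B FS′ B≤k (FS , S≤k) =
  TARPath-trans (TARPath-sym (forcing-mono S⊆B FS , B≤k) (⊆⇒TARPath S⊆B FS B≤k))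
                (⊆⇒TARPath S′⊆B FS′ B≤k)

-- A neighbour of S is either a superset of size ∣ S ∣ + 1 or a forcing proper subset.
minimal-isolated : IsMinimalSkewForcingSet G S → k ≤ ∣ S ∣ → TARPath G k S T → T ≡ S
minimal-isolated M k≤S here = refl
minimal-isolated M k≤S (there (_ , U≤k) (x , inj₁ (x∉S , refl)) _) =
  ⊥-elim (<⇒≱ (p⊂q⇒∣p∣<∣q∣ (x∉p⇒p⊂p∪⁅x⁆ x∉S)) (≤-trans U≤k k≤S))
minimal-isolated M k≤S (there (FU , _) (x , inj₂ (x∉U , refl)) _) =
  ⊥-elim (proj₂ M _ (x∉p⇒p⊂p∪⁅x⁆ x∉U) FU)

minimal-disconnects : IsMinimalSkewForcingSet G S → ∣ S ∣ ≡ k →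
                      TARVertex G k T → T ≢ S → ¬ TARConnected G k
minimal-disconnects {S = S} {T = T} M refl vT T≢S (_ , path) =
  T≢S (minimal-isolated M ≤-refl (path S T (proj₁ M , ≤-refl) vT))

-- The Full House graph

pattern va   = zero
pattern vb   = suc zero
pattern vc   = suc (suc zero)
pattern vd   = suc (suc (suc zero))
pattern nw i = suc (suc (suc (suc i)))

module _ {r : ℕ} where

  adj-a : ∀ (x : Fin (2 + r)) → Edge (FH r) (suc (suc x)) va
  adj-a zero             = refl
  adj-a (suc zero)       = refl
  adj-a (suc (suc _))    = refl

  adj-b : ∀ (x : Fin (2 + r)) → Edge (FH r) (suc (suc x)) vb
  adj-b zero             = refl
  adj-b (suc zero)       = refl
  adj-b (suc (suc _))    = refl

  nw∉ : ∀ {x₀ x₁ x₂ x₃} {t : Subset r} {i} → i ∉ t → nw i ∉ x₀ ∷ x₁ ∷ x₂ ∷ x₃ ∷ t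
  nw∉ i∉t (there (there (there (there i∈t)))) = i∉t i∈t

  nw∉⁻ : ∀ {x₀ x₁ x₂ x₃} {t : Subset r} {i} → nw i ∉ x₀ ∷ x₁ ∷ x₂ ∷ x₃ ∷ t → i ∉ t
  nw∉⁻ = drop-not-there ∘ drop-not-there ∘ drop-not-there ∘ drop-not-there

  new-twins : ∀ (i j : Fin r) → SameNeighbours (FH r) (nw i) (nw j)
  new-twins i j _ = refl

  -- Every vertex has two neighbours among a, b and any other vertex, so none has a unique
  -- white neighbour.
  ab-white-stalled : va ∉ B → vb ∉ B → suc (suc x) ∉ B → Stalled (FH r) B
  ab-white-stalled {x = x} a∉ b∉ x∉ va w (_ , _ , only) with only vb b∉ refl
  ... | refl with only (suc (suc x)) x∉ (Edge-sym {G = FH r} (adj-a x))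
  ... | ()
  ab-white-stalled {x = x} a∉ b∉ x∉ vb w (_ , _ , only) with only va a∉ refl
  ... | refl with only (suc (suc x)) x∉ (Edge-sym {G = FH r} (adj-b x))
  ... | ()
  ab-white-stalled a∉ b∉ x∉ (suc (suc u)) w (_ , _ , only) with only va a∉ (adj-a u)
  ... | refl with only vb b∉ (adj-b u)
  ... | ()

  ab-white-not-forcing : va ∉ S → vb ∉ S → suc (suc x) ∉ S → ¬ IsSkewForcingSet (FH r) S
  ab-white-not-forcing a∉ b∉ x∉ = stalled⇒not-forcing (ab-white-stalled a∉ b∉ x∉) a∉

  coreA coreB coreAB : Fin r → Subset (4 + r)
  coreA  j = true  ∷ false ∷ false ∷ false ∷ ∁ ⁅ j ⁆
  coreB  j = false ∷ true  ∷ false ∷ false ∷ ∁ ⁅ j ⁆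
  coreAB j = true  ∷ true  ∷ false ∷ false ∷ ∁ ⁅ j ⁆

  fullCD fullA fullACD : Subset (4 + r)
  fullCD  = false ∷ false ∷ true  ∷ true  ∷ ⊤
  fullA   = true  ∷ false ∷ false ∷ false ∷ ⊤
  fullACD = true  ∷ false ∷ true  ∷ true  ∷ ⊤

  new-forces-b : ∀ {x₂ x₃ t} j → SkewForce (FH r) (true ∷ false ∷ x₂ ∷ x₃ ∷ t) (nw j) vb
  new-forces-b j = (λ { (there ()) }) , refl , λ where
    va a∉ _ → contradiction here a∉
    vb _  _ → refl
    vc _  ()
    vd _  ()
    (nw _) _ ()

  new-forces-a : ∀ {x₂ x₃ t} j → SkewForce (FH r) (false ∷ true ∷ x₂ ∷ x₃ ∷ t) (nw j) va
  new-forces-a j = (λ ()) , refl , λ where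
    va _  _ → refl
    vb b∉ _ → contradiction (there here) b∉
    vc _  ()
    vd _  ()
    (nw _) _ ()

  c-forces-d : ∀ {x₂ t} → SkewForce (FH r) (true ∷ true ∷ x₂ ∷ false ∷ t) vc vd
  c-forces-d = (λ { (there (there (there ()))) }) , refl , λ where
    va a∉ _ → contradiction here a∉
    vb b∉ _ → contradiction (there here) b∉
    vc _  ()
    vd _  _ → refl
    (nw _) _ ()

  d-forces-c : ∀ {x₃ t} → SkewForce (FH r) (true ∷ true ∷ false ∷ x₃ ∷ t) vd vc
  d-forces-c = (λ { (there (there ())) }) , refl , λ where
    va a∉ _ → contradiction here a∉
    vb b∉ _ → contradiction (there here) b∉
    vc _  _ → refl
    vd _  ()
    (nw _) _ ()

  a-forces-new : ∀ {x₀} j → SkewForce (FH r) (x₀ ∷ true ∷ true ∷ true ∷ ∁ ⁅ j ⁆) va (nw j)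
  a-forces-new j = nw∉ (λ j∈ → x∈∁p⇒x∉p j∈ (x∈⁅x⁆ j)) , refl , λ where
    va _  ()
    vb b∉ _ → contradiction (there here) b∉
    vc c∉ _ → contradiction (there (there here)) c∉
    vd d∉ _ → contradiction (there (there (there here))) d∉
    (nw i) i∉ _ → cong (λ i → nw i) (x∈⁅y⁆⇒x≡y j (x∉∁p⇒x∈p (nw∉⁻ i∉)))

  b-forces-a : ∀ {x₁} → SkewForce (FH r) (false ∷ x₁ ∷ true ∷ true ∷ ⊤) vb va
  b-forces-a = (λ ()) , refl , λ where
    va _  _ → refl
    vb _  ()
    vc c∉ _ → contradiction (there (there here)) c∉
    vd d∉ _ → contradiction (there (there (there here))) d∉
    (nw _) i∉ _ → contradiction (there (there (there (there ∈⊤)))) i∉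

  coreAB-forcing : ∀ j → IsSkewForcingSet (FH r) (coreAB j)
  coreAB-forcing j = extend va (nw j) c-forced (a-forces-new j) nw-added
    where
    d-added : coreAB j ∪ ⁅ vd ⁆ ≡ true ∷ true ∷ false ∷ true ∷ ∁ ⁅ j ⁆
    d-added = cong (λ t → true ∷ true ∷ false ∷ true ∷ t) (∪-identityʳ _)
    c-added : (true ∷ true ∷ false ∷ true ∷ ∁ ⁅ j ⁆) ∪ ⁅ vc ⁆ ≡ true ∷ true ∷ true ∷ true ∷ ∁ ⁅ j ⁆
    c-added = cong (λ t → true ∷ true ∷ true ∷ true ∷ t) (∪-identityʳ _)
    c-forced : Reachable (FH r) (coreAB j) (true ∷ true ∷ true ∷ true ∷ ∁ ⁅ j ⁆)
    c-forced = extend vd vc (extend vc vd start c-forces-d d-added) d-forces-c c-added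
    nw-added : (true ∷ true ∷ true ∷ true ∷ ∁ ⁅ j ⁆) ∪ ⁅ nw j ⁆ ≡ ⊤
    nw-added = cong (λ t → true ∷ true ∷ true ∷ true ∷ t) (∁⁅x⁆∪⁅x⁆≡⊤ j)

  coreA-forcing : ∀ j → IsSkewForcingSet (FH r) (coreA j)
  coreA-forcing j = reachable-trans b-forced (coreAB-forcing j)
    where
    b-forced : Reachable (FH r) (coreA j) (coreAB j)
    b-forced = extend (nw j) vb start (new-forces-b j)
                 (cong (λ t → true ∷ true ∷ false ∷ false ∷ t) (∪-identityʳ _))

  coreB-forcing : ∀ j → IsSkewForcingSet (FH r) (coreB j)
  coreB-forcing j = reachable-trans a-forced (coreAB-forcing j)
    where
    a-forced : Reachable (FH r) (coreB j) (coreAB j)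
    a-forced = extend (nw j) va start (new-forces-a j)
                 (cong (λ t → true ∷ true ∷ false ∷ false ∷ t) (∪-identityʳ _))

  forcing⇒∁⁅i⁆⊆tail : ∀ {x₀ x₁ x₂ x₃ t i} → IsSkewForcingSet (FH r) (x₀ ∷ x₁ ∷ x₂ ∷ x₃ ∷ t) →
                      i ∉ t → ∁ ⁅ i ⁆ ⊆ t
  forcing⇒∁⁅i⁆⊆tail {t = t} {i} F i∉t {j} j∈∁i with j ∈? t
  ... | yes j∈t = j∈t
  ... | no j∉t  = ⊥-elim (twins-not-forcing (new-twins j i) nwj≢nwi (nw∉ j∉t) (nw∉ i∉t) F)
    where
    nwj≢nwi : nw j ≢ nw i
    nwj≢nwi refl = x∈∁p⇒x∉p j∈∁i (x∈⁅x⁆ j)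

  no-a-b⇒fullCD : ∀ {x₂ x₃ t} → IsSkewForcingSet (FH r) (false ∷ false ∷ x₂ ∷ x₃ ∷ t) →
                  false ∷ false ∷ x₂ ∷ x₃ ∷ t ≡ fullCD
  no-a-b⇒fullCD {false} F =
    ⊥-elim (ab-white-not-forcing {x = zero} (λ ()) (λ { (there ()) }) (λ { (there (there ())) }) F)
  no-a-b⇒fullCD {true} {false} F =
    ⊥-elim (ab-white-not-forcing {x = suc zero} (λ ()) (λ { (there ()) }) (λ { (there (there (there ()))) }) F)
  no-a-b⇒fullCD {true} {true} {t} F with p≡⊤⊎∃∉ t
  ... | inj₁ refl        = refl
  ... | inj₂ (i , i∉t)   =
    ⊥-elim (ab-white-not-forcing {x = suc (suc i)} (λ ()) (λ { (there ()) }) (nw∉ i∉t) F)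

module _ {n : ℕ} where

  private
    r : ℕ
    r = suc n

  fullA-forcing : IsSkewForcingSet (FH r) fullA
  fullA-forcing = forcing-mono (s⊆s (s⊆s (s⊆s (s⊆s ⊆⊤)))) (coreA-forcing zero)

  fullACD-forcing : IsSkewForcingSet (FH r) fullACD
  fullACD-forcing = forcing-mono (s⊆s (s⊆s (out⊆ (out⊆ ⊆⊤)))) (coreA-forcing zero)

  fullCD-forcing : IsSkewForcingSet (FH r) fullCD
  fullCD-forcing = reachable-trans a-forced fullACD-forcing
    where
    a-forced : Reachable (FH r) fullCD fullACD
    a-forced = extend vb va start b-forces-a
                 (cong (λ t → true ∷ false ∷ true ∷ true ∷ t) (∪-identityʳ ⊤))

  forcing⇒tail-cofinite : ∀ {x₀ x₁ x₂ x₃ t} → IsSkewForcingSet (FH r) (x₀ ∷ x₁ ∷ x₂ ∷ x₃ ∷ t) →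
                          ∃ λ j → ∁ ⁅ j ⁆ ⊆ t
  forcing⇒tail-cofinite {t = t} F with p≡⊤⊎∃∉ t
  ... | inj₁ refl      = zero , ⊆⊤
  ... | inj₂ (j , j∉t) = j , forcing⇒∁⁅i⁆⊆tail F j∉t

  forcing-cases : IsSkewForcingSet (FH r) S →
                  (∃ λ j → coreA j ⊆ S) ⊎ (∃ λ j → coreB j ⊆ S) ⊎ S ≡ fullCD
  forcing-cases {S = true ∷ _ ∷ _ ∷ _ ∷ _} F =
    let j , ∁j⊆t = forcing⇒tail-cofinite F in inj₁ (j , s⊆s (out⊆ (out⊆ (out⊆ ∁j⊆t))))
  forcing-cases {S = false ∷ true ∷ _ ∷ _ ∷ _} F =
    let j , ∁j⊆t = forcing⇒tail-cofinite F in inj₂ (inj₁ (j , s⊆s (s⊆s (out⊆ (out⊆ ∁j⊆t)))))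
  forcing-cases {S = false ∷ false ∷ _ ∷ _ ∷ _} F = inj₂ (inj₂ (no-a-b⇒fullCD F))

  ∣coreA∣ : ∀ (j : Fin r) → ∣ coreA j ∣ ≡ r
  ∣coreA∣ j = cong suc (∣∁⁅x⁆∣≡n j)

  ∣coreB∣ : ∀ (j : Fin r) → ∣ coreB j ∣ ≡ r
  ∣coreB∣ j = cong suc (∣∁⁅x⁆∣≡n j)

  ∣coreAB∣ : ∀ (j : Fin r) → ∣ coreAB j ∣ ≡ suc r
  ∣coreAB∣ j = cong (2 +_) (∣∁⁅x⁆∣≡n j)

  ∣fullA∣ : ∣ fullA {r} ∣ ≡ suc r
  ∣fullA∣ = cong suc (∣⊤∣≡n r)

  ∣fullCD∣ : ∣ fullCD {r} ∣ ≡ 2 + r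
  ∣fullCD∣ = cong (2 +_) (∣⊤∣≡n r)

  ∣fullACD∣ : ∣ fullACD {r} ∣ ≡ 3 + r
  ∣fullACD∣ = cong (3 +_) (∣⊤∣≡n r)

  forcing-size : IsSkewForcingSet (FH r) S → r ≤ ∣ S ∣
  forcing-size F with forcing-cases F
  ... | inj₁ (j , A⊆S)        = ≤-trans (≤-reflexive (≡-sym (∣coreA∣ j))) (p⊆q⇒∣p∣≤∣q∣ A⊆S)
  ... | inj₂ (inj₁ (j , B⊆S)) = ≤-trans (≤-reflexive (≡-sym (∣coreB∣ j))) (p⊆q⇒∣p∣≤∣q∣ B⊆S)
  ... | inj₂ (inj₂ refl)      = ≤-trans (m≤n+m r 2) (≤-reflexive (≡-sym ∣fullCD∣))

  zero-forcing-number : SkewZeroForcingNumber (FH r) r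
  zero-forcing-number = (coreA zero , coreA-forcing zero , ∣coreA∣ zero) , λ _ → forcing-size

  fullCD-minimal : IsMinimalSkewForcingSet (FH r) fullCD
  fullCD-minimal = fullCD-forcing , λ T T⊂CD FT → case forcing-cases FT of λ where
    (inj₁ (_ , A⊆T))        → contradiction (proj₁ T⊂CD (A⊆T here)) λ ()
    (inj₂ (inj₁ (_ , B⊆T))) → contradiction (proj₁ T⊂CD (B⊆T (there here))) λ { (there ()) }
    (inj₂ (inj₂ refl))      → ⊂-irref refl T⊂CD

  minimal-size : IsMinimalSkewForcingSet (FH r) S → ∣ S ∣ ≤ 2 + r
  minimal-size M with forcing-cases (proj₁ M)
  ... | inj₁ (j , A⊆S) with minimal-⊆ M A⊆S (coreA-forcing j)
  ...   | refl = ≤-trans (≤-reflexive (∣coreA∣ j)) (m≤n+m r 2)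
  minimal-size M | inj₂ (inj₁ (j , B⊆S)) with minimal-⊆ M B⊆S (coreB-forcing j)
  ...   | refl = ≤-trans (≤-reflexive (∣coreB∣ j)) (m≤n+m r 2)
  minimal-size M | inj₂ (inj₂ refl) = ≤-reflexive ∣fullCD∣

  upper-zero-forcing-number : UpperSkewZeroForcingNumber (FH r) (2 + r)
  upper-zero-forcing-number = (fullCD , fullCD-minimal , ∣fullCD∣) , λ _ → minimal-size

  coreA⊆fullA : ∀ (j : Fin r) → coreA j ⊆ fullA
  coreA⊆fullA j = s⊆s (s⊆s (s⊆s (s⊆s ⊆⊤)))

  fullA-vertex : suc r ≤ k → TARVertex (FH r) k fullA
  fullA-vertex r<k = fullA-forcing , ≤-trans (≤-reflexive ∣fullA∣) r<k

  fullA-reachable : suc r ≤ k → k ≢ 2 + r → TARVertex (FH r) k S → TARPath (FH r) k S fullA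
  fullA-reachable {k = k} r<k k≢2+r vS@(FS , S≤k) with forcing-cases FS
  ... | inj₁ (j , A⊆S) =
    common-subset⇒TARPath A⊆S (coreA⊆fullA j) (coreA-forcing j) S≤k (fullA-vertex r<k)
  ... | inj₂ (inj₁ (j , B⊆S)) = TARPath-trans
    (common-subset⇒TARPath B⊆S (out⊆ ⊆-refl) (coreB-forcing j) S≤k (coreAB-forcing j , AB≤k))
    (common-subset⇒TARPath (s⊆s (out⊆ ⊆-refl)) (coreA⊆fullA j) (coreA-forcing j) AB≤k
      (fullA-vertex r<k))
    where
    AB≤k : ∣ coreAB j ∣ ≤ k
    AB≤k = ≤-trans (≤-reflexive (∣coreAB∣ j)) r<k
  ... | inj₂ (inj₂ refl) =
    common-superset⇒TARPath (out⊆ ⊆-refl) (s⊆s (s⊆s (out⊆ (out⊆ ⊆-refl)))) fullA-forcing ACD≤k vS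
    where
    ACD≤k : ∣ fullACD {r} ∣ ≤ k
    ACD≤k = ≤-trans (≤-reflexive ∣fullACD∣)
                    (≤∧≢⇒< (≤-trans (≤-reflexive (≡-sym ∣fullCD∣)) S≤k) (k≢2+r ∘ ≡-sym))

  TAR-connected : suc r ≤ k → k ≢ 2 + r → TARConnected (FH r) k
  TAR-connected r<k k≢2+r = (fullA , fullA-vertex r<k) , λ _ _ vS vT →
    TARPath-trans (fullA-reachable r<k k≢2+r vS) (TARPath-sym vT (fullA-reachable r<k k≢2+r vT))

  TAR-disconnected-at-r : ¬ TARConnected (FH r) r
  TAR-disconnected-at-r = minimal-disconnects
    (minimum⇒minimal zero-forcing-number (coreA-forcing zero) (∣coreA∣ zero)) (∣coreA∣ zero)
    (coreB-forcing zero , ≤-reflexive (∣coreB∣ zero)) (λ ())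

  TAR-disconnected-at-2+r : ¬ TARConnected (FH r) (2 + r)
  TAR-disconnected-at-2+r = minimal-disconnects fullCD-minimal ∣fullCD∣ (fullA-vertex (n≤1+n _)) (λ ())

  lower-TAR-number : LowerSkewTARConnNumber (FH r) (suc r)
  lower-TAR-number = TAR-connected ≤-refl (λ ()) , λ k conn → at-least conn
    where
    at-least : TARConnected (FH r) k → suc r ≤ k
    at-least conn@((_ , FS , S≤k) , _) =
      ≤∧≢⇒< (≤-trans (forcing-size FS) S≤k) λ { refl → TAR-disconnected-at-r conn }

  TAR-number : SkewTARConnNumber (FH r) (3 + r)
  TAR-number = (λ k 3+r≤k → TAR-connected (≤-trans (m≤n+m (suc r) 2) 3+r≤k) (≢2+r 3+r≤k)) , at-least
    where
    ≢2+r : 3 + r ≤ k → k ≢ 2 + r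
    ≢2+r 3+r≤k refl = n≮n _ 3+r≤k

    at-least : ∀ k₀ → (∀ k → k₀ ≤ k → TARConnected (FH r) k) → 3 + r ≤ k₀
    at-least k₀ connected with 3 + r ≤? k₀
    ... | yes 3+r≤k₀ = 3+r≤k₀
    ... | no 3+r≰k₀  = ⊥-elim (TAR-disconnected-at-2+r (connected (2 + r) (≤-pred (≰⇒> 3+r≰k₀))))

proposition5p11 : (r : ℕ) → 1 ≤ r →
    SkewZeroForcingNumber (FH r) r ×
    UpperSkewZeroForcingNumber (FH r) (r + 2) ×
    LowerSkewTARConnNumber (FH r) (r + 1) ×
    SkewTARConnNumber (FH r) (r + 3)
proposition5p11 r@(suc _) _ =
  zero-forcing-number ,
  subst (UpperSkewZeroForcingNumber (FH r)) (+-comm 2 r) upper-zero-forcing-number ,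
  subst (LowerSkewTARConnNumber (FH r)) (+-comm 1 r) lower-TAR-number ,
  subst (SkewTARConnNumber (FH r)) (+-comm 3 r) TAR-number
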